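{- Let $n\geq 3$, $n_1\geq 1$ and $n_2\geq 1$ be integers. Then: (1) $\gamma_{t[1,2]}(K_n)=\gamma_{t[1,2]}(K_{n_1,n_2})=2$; (2) $\gamma_{t[1,2]}(P_n)=\gamma_{t[1,2]}(C_n)=\frac{n+1}{2}$ if $n\equiv 1 \pmod 2$, $=\frac{n}{2}+1$ if $n\equiv 2\pmod 4$, and $=\frac{n}{2}$ if $n\equiv 0 \pmod 4$; (3) if $G=H\circ 2P_2$ for a connected graph $H$ of order at least two, then $\gamma_{t[1,2]}(G)=\frac{4n}{5}$, where $n$ is the order of $G$.
   Context: All graphs are finite, simple and undirected; $N(v)$ denotes the (open) neighborhood of a vertex $v$. For a graph $G=(V,E)$, a set $S\subseteq V$ is a total $[1,2]$-set if $1\leq |N(v)\cap S|\leq 2$ for every vertex $v\in V$. The total $[1,2]$-domination number $\gamma_{t[1,2]}(G)$ is the minimum cardinality of a total $[1,2]$-set of $G$ (and $\gamma_{t[1,2]}(G)=+\infty$ if $G$ has no total $[1,2]$-set). $K_n$, $K_{n_1,n_2}$, $P_n$, $C_n$ denote the complete graph, complete bipartite graph, path and cycle. For a graph $H$ with vertex set $\{u_1,\dots,u_k\}$, the double corona $H\circ 2P_2$ is the graph with vertex set $V(H)\cup\{x_i,x_i',y_i,y_i' : 1\leq i\leq k\}$ (all new vertices distinct) and edge set $E(H)\cup\{u_ix_i,\,x_ix_i',\,u_iy_i,\,y_iy_i' : 1\leq i\leq k\}$, i.e. two pendant paths with two vertices each are attached to every vertex of $H$. -}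

module Defs where

open import Data.Nat using (ℕ; zero; suc; _+_; _*_; _∸_; _≤_; _≡ᵇ_)
open import Data.Nat.Properties using ()
open import Data.Bool using (Bool; true; false; not; _∧_; _∨_; if_then_else_)
open import Data.Bool.Properties using (∨-comm)
open import Data.Fin using (Fin; toℕ; _≟_; remQuot)
import Data.Nat
open import Data.Fin.Subset using (Subset; _∩_; ∣_∣)
open import Data.Vec using (tabulate)
open import Data.Product using (_×_; _,_; proj₁; proj₂; ∃-syntax)
open import Relation.Nullary.Decidable using (⌊_⌋; yes; no)
open import Relation.Binary.PropositionalEquality using (_≡_; refl; sym; cong₂)

record Graph : Set where
  field
    n      : ℕ
    adj    : Fin n → Fin n → Bool
    adj-sym    : ∀ u v → adj u v ≡ adj v u
    adj-irrefl : ∀ v → adj v v ≡ false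

open Graph public

order : Graph → ℕ
order G = n G

N : (G : Graph) → Fin (n G) → Subset (n G)
N G v = tabulate (adj G v)

IsTotal12Set : (G : Graph) → Subset (n G) → Set
IsTotal12Set G S = ∀ v → 1 ≤ ∣ N G v ∩ S ∣ × ∣ N G v ∩ S ∣ ≤ 2

IsGammaT12 : Graph → ℕ → Set
IsGammaT12 G k =
  (∃[ S ] (IsTotal12Set G S × ∣ S ∣ ≡ k)) ×
  (∀ S → IsTotal12Set G S → k ≤ ∣ S ∣)

data Reachable (G : Graph) : Fin (n G) → Fin (n G) → Set where
  here : ∀ {v} → Reachable G v v
  step : ∀ {u w v} → adj G u w ≡ true → Reachable G w v → Reachable G u v

Connected : Graph → Set
Connected G = ∀ u v → Reachable G u v

private
  ≟-sym : ∀ {m} (u v : Fin m) → ⌊ u ≟ v ⌋ ≡ ⌊ v ≟ u ⌋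
  ≟-sym u v with u ≟ v | v ≟ u
  ... | yes _ | yes _ = refl
  ... | no _  | no _  = refl
  ... | yes p | no q  with q (sym p)
  ... | ()
  ≟-sym u v | no p | yes q with p (sym q)
  ... | ()

  ≟-refl : ∀ {m} (u : Fin m) → ⌊ u ≟ u ⌋ ≡ true
  ≟-refl u with u ≟ u
  ... | yes _ = refl
  ... | no p with p refl
  ... | ()

mkGraph : (m : ℕ) → (Fin m → Fin m → Bool) → Graph
mkGraph m r = record
  { n      = m
  ; adj    = λ u v → not ⌊ u ≟ v ⌋ ∧ (r u v ∨ r v u)
  ; adj-sym    = λ u v → cong₂ (λ a b → not a ∧ b) (≟-sym u v) (∨-comm (r u v) (r v u))
  ; adj-irrefl = λ v → cong₂ (λ a b → not a ∧ b) (≟-refl v) refl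
  }

K : ℕ → Graph
K m = mkGraph m (λ _ _ → true)

-- complete bipartite graph K_{n1,n2}: vertices 0..n1-1 form one side,
-- n1..n1+n2-1 the other side.
Kbip : ℕ → ℕ → Graph
Kbip n1 n2 = mkGraph (n1 + n2) (λ u v → side u ∧ not (side v))
  where
  side : Fin (n1 + n2) → Bool
  side u = ⌊ Data.Nat._<?_ (toℕ u) n1 ⌋

P : ℕ → Graph
P m = mkGraph m (λ u v → suc (toℕ u) ≡ᵇ toℕ v)

-- cycle C_m : the path plus the edge {m-1, 0}  (a cycle for m ≥ 3)
C : ℕ → Graph
C m = mkGraph m (λ u v → (suc (toℕ u) ≡ᵇ toℕ v) ∨ ((toℕ u ≡ᵇ m ∸ 1) ∧ (toℕ v ≡ᵇ 0)))

-- double corona H ∘ 2P_2.  Vertex set Fin (5 * k) with k = order H;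
-- remQuot k splits a vertex into (block b : Fin 5, index i : Fin k):
-- block 0 = u_i, 1 = x_i, 2 = x'_i, 3 = y_i, 4 = y'_i.
doubleCorona : Graph → Graph
doubleCorona H = mkGraph (5 * k) r
  where
  k = n H
  r : Fin (5 * k) → Fin (5 * k) → Bool
  r a b with remQuot {5} k a | remQuot {5} k b
  ... | (ba , i) | (bb , j) with toℕ ba | toℕ bb
  ... | 0 | 0 = adj H i j
  ... | 0 | 1 = ⌊ i ≟ j ⌋
  ... | 1 | 2 = ⌊ i ≟ j ⌋
  ... | 0 | 3 = ⌊ i ≟ j ⌋
  ... | 3 | 4 = ⌊ i ≟ j ⌋
  ... | _ | _ = false

-- A total [1,2]-set S contains a vertex u dominating some v and a vertex
-- dominating u, so |S| ≥ 2.  In a cycle every vertex has a neighbour in S and every vertex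
-- has at most two neighbours, so double counting the pairs (v , s) with s ∈ N(v) ∩ S gives
-- n ≤ 2|S|.  When n = 2k with k odd the same count between the odd vertices and the even
-- members of S (the cycle is bipartite) gives k ≤ 2|S ∩ evens|, likewise k ≤ 2|S ∩ odds|,
-- so |S| ≥ 2⌈k/2⌉ = k + 1.  A total [1,2]-set of P_n is one of C_n, so these bounds hold
-- for paths too.
--
-- Upper bounds.  {0 , 1} in K_n and one vertex from each side of K_{n₁,n₂}; in P_n the
-- pattern 0110 0110 ⋯ 0110 followed by 011, 01110, 11 or nothing, which is also a total
-- [1,2]-set of C_n.
--
-- The pendant vertices x′ᵢ, y′ᵢ force xᵢ, yᵢ into S.  If uᵢ were in S, an
-- H-neighbour uⱼ of uᵢ would have the three S-neighbours xⱼ, yⱼ, uᵢ; so no uᵢ is in S, and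
-- then xᵢ, yᵢ force x′ᵢ, y′ᵢ into S.  Hence S contains the 4k vertices outside H, and these
-- form a total [1,2]-set.
module Submission where

open import Defs
open import Data.Bool using (Bool; true; false; not; _∧_; _∨_; T; if_then_else_)
open import Data.Bool.Properties using (∨-identityʳ; ∧-zeroʳ; ∧-identityʳ; not-involutive)
open import Data.Fin using (Fin; zero; suc; toℕ; _≟_; _↑ˡ_; _↑ʳ_; combine; remQuot; quotRem)
open import Data.Fin.Patterns using (0F; 1F; 2F; 3F; 4F)
open import Data.Fin.Properties
  using (toℕ-↑ʳ; toℕ<n; remQuot-combine; combine-remQuot; combine-injective)
open import Data.Fin.Subset using (Subset; _∈_; _∉_; _⊆_; _∩_; ∣_∣; Nonempty; ⊥; ⊤)
open import Data.Fin.Subset.Properties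
  using ( ∣p∩q∣≤∣p∣; ∣p∩q∣≤∣q∣; x∈p∩q⁺; x∈p∩q⁻; p⊆q⇒∣p∣≤∣q∣; ∣⁅x⁆∣≡1; x∈⁅y⁆⇒x≡y; nonempty?
        ; Empty-unique; ∣⊥∣≡0; ∣⊤∣≡n; ∉⊥; ∈⊤; x∈p⇒∣p-x∣<∣p∣; x∈p∧x≢y⇒x∈p-y)
open import Data.Nat
  using (ℕ; zero; suc; NonZero; _+_; _*_; _∸_; _≤_; _<_; z≤n; s≤s; s≤s⁻¹; _≡ᵇ_; _/_; _%_; _<?_; _≤?_)
open import Data.Nat.DivMod using ([m+kn]%n≡m%n; m*n/n≡m)
open import Data.Nat.Properties
  using ( module ≤-Reasoning; ≡ᵇ⇒≡; ≤⇒≯; ≰⇒>; m≤m+n; m≤n+m; ≤-refl; ≤-trans; ≤-antisym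
        ; ≤-reflexive; +-mono-≤; +-monoˡ-≤; +-assoc; +-comm; +-identityʳ; *-identityʳ
        ; *-cancelˡ-<; <-irrefl; <⇒≢; n<1+n; +-0-commutativeMonoid; +-*-semiring)
  renaming (_≟_ to _≟ℕ_)
open import Data.Nat.Tactic.RingSolver using (solve-∀)
open import Algebra.Properties.CommutativeMonoid.Sum +-0-commutativeMonoid
  using (sum; sum-syntax; ∑-comm; ∑-distrib-+; sum-cong-≗; sum-replicate-zero)
open import Algebra.Properties.Semiring.Sum +-*-semiring using (*-distribˡ-sum)
open import Data.Product using (_×_; _,_; proj₁; proj₂; ∃-syntax; swap)
open import Data.Sum as Sum using (_⊎_; inj₁; inj₂)
open import Data.Vec using ([]; _∷_; _++_; lookup; tabulate; here; there)
open import Data.Vec.Properties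
  using (lookup-++ˡ; lookup-++ʳ; lookup∘tabulate; lookup-zipWith; []=⇒lookup; lookup⇒[]=)
open import Function using (_∘_)
open import Relation.Binary.PropositionalEquality
open import Relation.Nullary using (¬_; Dec; yes; no; contradiction)
open import Relation.Nullary.Decidable using (⌊_⌋; toWitness; isYes≗does; dec-false; dec-true)

∧-true⁻ : ∀ a {b} → a ∧ b ≡ true → a ≡ true × b ≡ true
∧-true⁻ true ab = refl , ab

∨-true⁻ : ∀ a {b} → a ∨ b ≡ true → a ≡ true ⊎ b ≡ true
∨-true⁻ true  _  = inj₁ refl
∨-true⁻ false ab = inj₂ ab

∨-false⁻ : ∀ {a} → a ∨ false ≡ true → a ≡ true
∨-false⁻ {a} = trans (sym (∨-identityʳ a))

≡ᵇ-true⇒≡ : ∀ a b → (a ≡ᵇ b) ≡ true → a ≡ b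
≡ᵇ-true⇒≡ a b e = ≡ᵇ⇒≡ a b (subst T (sym e) _)

⌊⌋-true : ∀ {a} {A : Set a} (A? : Dec A) → A → ⌊ A? ⌋ ≡ true
⌊⌋-true A? a = trans (isYes≗does A?) (dec-true A? a)

⌊⌋-true⁻ : ∀ {a} {A : Set a} {A? : Dec A} → ⌊ A? ⌋ ≡ true → A
⌊⌋-true⁻ e = toWitness (subst T (sym e) _)

⌊⌋-false : ∀ {a} {A : Set a} (A? : Dec A) → ¬ A → ⌊ A? ⌋ ≡ false
⌊⌋-false A? ¬a = trans (isYes≗does A?) (dec-false A? ¬a)

2t≤n+1⇒n≤2s⇒t≤s : ∀ {t n s} → 2 * t ≤ n + 1 → n ≤ 2 * s → t ≤ s
2t≤n+1⇒n≤2s⇒t≤s {t} {n} {s} 2t≤n+1 n≤2s = s≤s⁻¹ (*-cancelˡ-< 2 t (suc s) (begin-strict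
  2 * t            ≤⟨ 2t≤n+1 ⟩
  n + 1            ≤⟨ +-monoˡ-≤ 1 n≤2s ⟩
  2 * s + 1        <⟨ n<1+n _ ⟩
  suc (2 * s + 1)  ≡⟨ 2s+2≡2[1+s] s ⟩
  2 * suc s        ∎))
  where
  open ≤-Reasoning
  2s+2≡2[1+s] : ∀ s → suc (2 * s + 1) ≡ 2 * suc s
  2s+2≡2[1+s] = solve-∀

x≡y*d⇒x/d≡y : ∀ {x} y d → .{{_ : NonZero d}} → x ≡ y * d → x / d ≡ y
x≡y*d⇒x/d≡y y d refl = m*n/n≡m y d

𝟙 : Bool → ℕ
𝟙 true  = 1
𝟙 false = 0

𝟙[a∧b]≤𝟙[b] : ∀ a b → 𝟙 (a ∧ b) ≤ 𝟙 b
𝟙[a∧b]≤𝟙[b] true  b = ≤-refl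
𝟙[a∧b]≤𝟙[b] false b = z≤n

𝟙[m≡ᵇm] : ∀ m → 𝟙 (m ≡ᵇ m) ≡ 1
𝟙[m≡ᵇm] zero    = refl
𝟙[m≡ᵇm] (suc m) = 𝟙[m≡ᵇm] m

∑-mono-≤ : ∀ {n} {f g : Fin n → ℕ} → (∀ i → f i ≤ g i) → sum f ≤ sum g
∑-mono-≤ {zero}  _   = z≤n
∑-mono-≤ {suc n} f≤g = +-mono-≤ (f≤g zero) (∑-mono-≤ (f≤g ∘ suc))

∑𝟙[toℕ≡ᵇ]≤1 : ∀ n a → ∑[ x < n ] 𝟙 (toℕ x ≡ᵇ a) ≤ 1
∑𝟙[toℕ≡ᵇ]≤1 zero    a       = z≤n
∑𝟙[toℕ≡ᵇ]≤1 (suc n) zero    = s≤s (≤-reflexive (sum-replicate-zero n))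
∑𝟙[toℕ≡ᵇ]≤1 (suc n) (suc a) = ∑𝟙[toℕ≡ᵇ]≤1 n a

∑𝟙-period-2 : ∀ k (g : ℕ → Bool) → (∀ j → g (suc (suc j)) ≡ g j) →
              ∑[ i < k * 2 ] 𝟙 (g (toℕ i)) ≡ k * (𝟙 (g 0) + 𝟙 (g 1))
∑𝟙-period-2 zero    g periodic = refl
∑𝟙-period-2 (suc k) g periodic = begin
  𝟙 (g 0) + (𝟙 (g 1) + ∑[ i < k * 2 ] 𝟙 (g (suc (suc (toℕ i)))))
    ≡⟨ cong (λ s → 𝟙 (g 0) + (𝟙 (g 1) + s))
            (trans (sum-cong-≗ {k * 2} λ i → cong 𝟙 (periodic (toℕ i))) (∑𝟙-period-2 k g periodic)) ⟩
  𝟙 (g 0) + (𝟙 (g 1) + k * (𝟙 (g 0) + 𝟙 (g 1)))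
    ≡⟨ sym (+-assoc (𝟙 (g 0)) _ _) ⟩
  suc k * (𝟙 (g 0) + 𝟙 (g 1))  ∎
  where open ≡-Reasoning

∣p∣≡∑𝟙 : ∀ {n} (p : Subset n) → ∣ p ∣ ≡ ∑[ i < n ] 𝟙 (lookup p i)
∣p∣≡∑𝟙 []          = refl
∣p∣≡∑𝟙 (true ∷ p)  = cong suc (∣p∣≡∑𝟙 p)
∣p∣≡∑𝟙 (false ∷ p) = ∣p∣≡∑𝟙 p

∣tabulate∣≡∑𝟙 : ∀ {n} (f : Fin n → Bool) → ∣ tabulate f ∣ ≡ ∑[ i < n ] 𝟙 (f i)
∣tabulate∣≡∑𝟙 f = trans (∣p∣≡∑𝟙 (tabulate f)) (sum-cong-≗ λ i → cong 𝟙 (lookup∘tabulate f i))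

∣tabulate∩∣≡∑𝟙 : ∀ {n} (f : Fin n → Bool) (p : Subset n) →
                 ∣ tabulate f ∩ p ∣ ≡ ∑[ i < n ] 𝟙 (f i ∧ lookup p i)
∣tabulate∩∣≡∑𝟙 f p = trans (∣p∣≡∑𝟙 (tabulate f ∩ p)) (sum-cong-≗ λ i →
  cong 𝟙 (trans (lookup-zipWith _∧_ i (tabulate f) p) (cong (_∧ lookup p i) (lookup∘tabulate f i))))

∣p∣≡∣f∩p∣+∣¬f∩p∣ : ∀ {n} (f : Fin n → Bool) (p : Subset n) →
                   ∣ p ∣ ≡ ∣ tabulate f ∩ p ∣ + ∣ tabulate (not ∘ f) ∩ p ∣
∣p∣≡∣f∩p∣+∣¬f∩p∣ {n} f p = begin
  ∣ p ∣
    ≡⟨ ∣p∣≡∑𝟙 p ⟩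
  ∑[ i < n ] 𝟙 (lookup p i)
    ≡⟨ sum-cong-≗ (λ i → split (f i) (lookup p i)) ⟩
  ∑[ i < n ] (𝟙 (f i ∧ lookup p i) + 𝟙 (not (f i) ∧ lookup p i))
    ≡⟨ ∑-distrib-+ {n} (λ i → 𝟙 (f i ∧ lookup p i)) _ ⟩
  ∑[ i < n ] 𝟙 (f i ∧ lookup p i) + ∑[ i < n ] 𝟙 (not (f i) ∧ lookup p i)
    ≡⟨ sym (cong₂ _+_ (∣tabulate∩∣≡∑𝟙 f p) (∣tabulate∩∣≡∑𝟙 (not ∘ f) p)) ⟩
  ∣ tabulate f ∩ p ∣ + ∣ tabulate (not ∘ f) ∩ p ∣
    ∎
  where
  open ≡-Reasoning
  split : ∀ a b → 𝟙 b ≡ 𝟙 (a ∧ b) + 𝟙 (not a ∧ b)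
  split true  b = sym (+-identityʳ (𝟙 b))
  split false b = refl

∣p++q∣≡∣p∣+∣q∣ : ∀ {m n} (p : Subset m) (q : Subset n) → ∣ p ++ q ∣ ≡ ∣ p ∣ + ∣ q ∣
∣p++q∣≡∣p∣+∣q∣ []          q = refl
∣p++q∣≡∣p∣+∣q∣ (true ∷ p)  q = cong suc (∣p++q∣≡∣p∣+∣q∣ p q)
∣p++q∣≡∣p∣+∣q∣ (false ∷ p) q = ∣p++q∣≡∣p∣+∣q∣ p q

∈tabulate⁺ : ∀ {n} {f : Fin n → Bool} {x} → f x ≡ true → x ∈ tabulate f
∈tabulate⁺ {f = f} {x} fx = lookup⇒[]= x (tabulate f) (trans (lookup∘tabulate f x) fx)

∈tabulate⁻ : ∀ {n} {f : Fin n → Bool} {x} → x ∈ tabulate f → f x ≡ true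
∈tabulate⁻ {f = f} {x} x∈ = trans (sym (lookup∘tabulate f x)) ([]=⇒lookup x∈)

∈-++ʳ : ∀ {m n} (p : Subset m) {q : Subset n} {x} → x ∈ q → m ↑ʳ x ∈ p ++ q
∈-++ʳ {m} p {q} {x} x∈q = lookup⇒[]= (m ↑ʳ x) (p ++ q) (trans (lookup-++ʳ p q x) ([]=⇒lookup x∈q))

∉-++ˡ : ∀ {m n} {p : Subset m} (q : Subset n) {x} → x ∉ p → x ↑ˡ n ∉ p ++ q
∉-++ˡ {p = p} q {x} x∉p x∈ = x∉p (lookup⇒[]= x p (trans (sym (lookup-++ˡ p q x)) ([]=⇒lookup x∈)))

x∈p⇒1≤∣p∣ : ∀ {n} {p : Subset n} {x} → x ∈ p → 1 ≤ ∣ p ∣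
x∈p⇒1≤∣p∣ {p = p} {x} x∈p = subst (_≤ ∣ p ∣) (∣⁅x⁆∣≡1 x)
  (p⊆q⇒∣p∣≤∣q∣ λ y∈⁅x⁆ → subst (_∈ p) (sym (x∈⁅y⁆⇒x≡y x y∈⁅x⁆)) x∈p)

1≤∣p∣⇒Nonempty : ∀ {n} (p : Subset n) → 1 ≤ ∣ p ∣ → Nonempty p
1≤∣p∣⇒Nonempty {n} p 1≤∣p∣ with nonempty? p
... | yes ne = ne
... | no ¬ne = contradiction (subst (1 ≤_) (trans (cong ∣_∣ (Empty-unique ¬ne)) (∣⊥∣≡0 n)) 1≤∣p∣) λ ()

2≤∣p∣ : ∀ {n} {p : Subset n} {x y} → x ∈ p → y ∈ p → x ≢ y → 2 ≤ ∣ p ∣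
2≤∣p∣ x∈p y∈p x≢y =
  ≤-trans (s≤s (x∈p⇒1≤∣p∣ (x∈p∧x≢y⇒x∈p-y y∈p (x≢y ∘ sym)))) (x∈p⇒∣p-x∣<∣p∣ x∈p)

3≤∣p∣ : ∀ {n} {p : Subset n} {x y z} → x ∈ p → y ∈ p → z ∈ p →
        x ≢ y → x ≢ z → y ≢ z → 3 ≤ ∣ p ∣
3≤∣p∣ x∈p y∈p z∈p x≢y x≢z y≢z =
  ≤-trans (s≤s (2≤∣p∣ (x∈p∧x≢y⇒x∈p-y y∈p (x≢y ∘ sym)) (x∈p∧x≢y⇒x∈p-y z∈p (x≢z ∘ sym)) y≢z))
          (x∈p⇒∣p-x∣<∣p∣ x∈p)

∣p∣≤2 : ∀ {n} (p : Subset n) a b → (∀ {x} → x ∈ p → toℕ x ≡ a ⊎ toℕ x ≡ b) → ∣ p ∣ ≤ 2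
∣p∣≤2 {n} p a b p⊆ab = begin
  ∣ p ∣                                          ≡⟨ ∣p∣≡∑𝟙 p ⟩
  ∑[ x < n ] 𝟙 (lookup p x)                      ≤⟨ ∑-mono-≤ pointwise ⟩
  ∑[ x < n ] (𝟙 (toℕ x ≡ᵇ a) + 𝟙 (toℕ x ≡ᵇ b))  ≡⟨ ∑-distrib-+ {n} (λ x → 𝟙 (toℕ x ≡ᵇ a)) _ ⟩
  ∑[ x < n ] 𝟙 (toℕ x ≡ᵇ a) + ∑[ x < n ] 𝟙 (toℕ x ≡ᵇ b)
                                                 ≤⟨ +-mono-≤ (∑𝟙[toℕ≡ᵇ]≤1 n a) (∑𝟙[toℕ≡ᵇ]≤1 n b) ⟩
  2                                              ∎
  where
  open ≤-Reasoning
  pointwise : ∀ x → 𝟙 (lookup p x) ≤ 𝟙 (toℕ x ≡ᵇ a) + 𝟙 (toℕ x ≡ᵇ b)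
  pointwise x with lookup p x in x∈p
  ... | false = z≤n
  ... | true with p⊆ab (lookup⇒[]= x p x∈p)
  ...   | inj₁ refl = ≤-trans (≤-reflexive (sym (𝟙[m≡ᵇm] (toℕ x)))) (m≤m+n _ _)
  ...   | inj₂ refl = ≤-trans (≤-reflexive (sym (𝟙[m≡ᵇm] (toℕ x)))) (m≤n+m _ _)

-- Total dominating sets

adj⇒≢ : ∀ (G : Graph) {u v} → adj G u v ≡ true → u ≢ v
adj⇒≢ G {u} uv refl = contradiction (trans (sym (adj-irrefl G u)) uv) λ ()

adj-mkGraph⁺ : ∀ {m r} {u v : Fin m} → u ≢ v → r u v ≡ true → adj (mkGraph m r) u v ≡ true
adj-mkGraph⁺ {u = u} {v} u≢v ruv rewrite ⌊⌋-false (u ≟ v) u≢v | ruv = refl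

adj-mkGraph⁻ : ∀ {m r} {u v : Fin m} → adj (mkGraph m r) u v ≡ true → r u v ≡ true ⊎ r v u ≡ true
adj-mkGraph⁻ {u = u} {v} uv = ∨-true⁻ _ (proj₂ (∧-true⁻ (not ⌊ u ≟ v ⌋) uv))

adj-mkGraph-mono : ∀ {m r r′} {u v : Fin m} → (∀ {a b} → r a b ≡ true → r′ a b ≡ true) →
                   adj (mkGraph m r) u v ≡ true → adj (mkGraph m r′) u v ≡ true
adj-mkGraph-mono {m} {r} {r′} {u} {v} r⊆r′ uv with adj-mkGraph⁻ {m} {r} uv
... | inj₁ ruv = adj-mkGraph⁺ {m} {r′} (adj⇒≢ (mkGraph m r) uv) (r⊆r′ ruv)
... | inj₂ rvu = trans (adj-sym (mkGraph m r′) u v)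
                       (adj-mkGraph⁺ {m} {r′} (adj⇒≢ (mkGraph m r) uv ∘ sym) (r⊆r′ rvu))

Reachable⇒neighbour : ∀ (G : Graph) {u v} → Reachable G u v → u ≢ v → ∃[ w ] adj G u w ≡ true
Reachable⇒neighbour G here       u≢v = contradiction refl u≢v
Reachable⇒neighbour G (step e _) _   = _ , e

∃≢ : ∀ {m} → 2 ≤ m → (i : Fin m) → ∃[ j ] i ≢ j
∃≢ (s≤s (s≤s _)) zero    = suc zero , λ ()
∃≢ (s≤s (s≤s _)) (suc i) = zero , λ ()

connected⇒neighbour : ∀ (G : Graph) → Connected G → 2 ≤ n G → ∀ i → ∃[ j ] adj G i j ≡ true
connected⇒neighbour G conn 2≤n i with ∃≢ 2≤n i
... | j , i≢j = Reachable⇒neighbour G (conn i j) i≢j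

IsTotalDominatingSet : (G : Graph) → Subset (n G) → Set
IsTotalDominatingSet G S = ∀ v → ∃[ u ] (adj G v u ≡ true × u ∈ S)

∈N∩⁺ : ∀ (G : Graph) {S v u} → adj G v u ≡ true → u ∈ S → u ∈ N G v ∩ S
∈N∩⁺ G vu u∈S = x∈p∩q⁺ (∈tabulate⁺ vu , u∈S)

∈N∩⁻ : ∀ (G : Graph) {S v u} → u ∈ N G v ∩ S → adj G v u ≡ true × u ∈ S
∈N∩⁻ G {S} {v} u∈ with x∈p∩q⁻ (N G v) S u∈
... | u∈N , u∈S = ∈tabulate⁻ u∈N , u∈S

total12⇒dominating : ∀ (G : Graph) {S} → IsTotal12Set G S → IsTotalDominatingSet G S
total12⇒dominating G {S} T v with 1≤∣p∣⇒Nonempty (N G v ∩ S) (proj₁ (T v))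
... | u , u∈ = u , ∈N∩⁻ G u∈

dominating⇒total12 : ∀ (G : Graph) {S} → IsTotalDominatingSet G S →
                     (∀ v → ∣ N G v ∩ S ∣ ≤ 2) → IsTotal12Set G S
dominating⇒total12 G D ≤2 v with D v
... | u , vu , u∈S = x∈p⇒1≤∣p∣ (∈N∩⁺ G vu u∈S) , ≤2 v

dominating⇒total12-of-degree≤2 : ∀ (G : Graph) {S} → (∀ v → ∣ N G v ∣ ≤ 2) →
                                  IsTotalDominatingSet G S → IsTotal12Set G S
dominating⇒total12-of-degree≤2 G {S} deg D =
  dominating⇒total12 G D λ v → ≤-trans (∣p∩q∣≤∣p∣ (N G v) S) (deg v)

γ-intro : ∀ {G : Graph} {k} S → IsTotal12Set G S → ∣ S ∣ ≤ k →
          (∀ S′ → IsTotal12Set G S′ → k ≤ ∣ S′ ∣) → IsGammaT12 G k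
γ-intro S T ∣S∣≤k minimal = (S , T , ≤-antisym ∣S∣≤k (minimal S T)) , minimal

2≤∣total12∣ : ∀ (G : Graph) {S} → Fin (n G) → IsTotal12Set G S → 2 ≤ ∣ S ∣
2≤∣total12∣ G v T with total12⇒dominating G T v
... | u , _ , u∈S with total12⇒dominating G T u
... | w , uw , w∈S = 2≤∣p∣ u∈S w∈S (adj⇒≢ G uw)

∣A∣≤d*∣B∣ : ∀ (G : Graph) {A B : Subset (n G)} d →
            (∀ {v} → v ∈ A → ∃[ u ] (adj G v u ≡ true × u ∈ B)) → (∀ u → ∣ N G u ∣ ≤ d) →
            ∣ A ∣ ≤ d * ∣ B ∣
∣A∣≤d*∣B∣ G {A} {B} d dom deg = begin
  ∣ A ∣                                      ≡⟨ ∣p∣≡∑𝟙 A ⟩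
  ∑[ v < m ] 𝟙 (A ! v)                       ≤⟨ ∑-mono-≤ A-side ⟩
  ∑[ v < m ] ∑[ u < m ] 𝟙 (A ! v ∧ E v u)    ≡⟨ ∑-comm (λ v u → 𝟙 (A ! v ∧ E v u)) ⟩
  ∑[ u < m ] ∑[ v < m ] 𝟙 (A ! v ∧ E v u)    ≤⟨ ∑-mono-≤ B-side ⟩
  ∑[ u < m ] (d * 𝟙 (B ! u))                 ≡⟨ sym (*-distribˡ-sum d (λ u → 𝟙 (B ! u))) ⟩
  d * ∑[ u < m ] 𝟙 (B ! u)                   ≡⟨ cong (d *_) (sym (∣p∣≡∑𝟙 B)) ⟩
  d * ∣ B ∣                                  ∎
  where
  open ≤-Reasoning
  m = n G
  _!_ : Subset m → Fin m → Bool
  p ! i = lookup p i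
  E : Fin m → Fin m → Bool
  E v u = adj G v u ∧ B ! u

  A-side : ∀ v → 𝟙 (A ! v) ≤ ∑[ u < m ] 𝟙 (A ! v ∧ E v u)
  A-side v with A ! v in v∈A
  ... | false = z≤n
  ... | true with dom (lookup⇒[]= v A v∈A)
  ...   | _ , vu , u∈B = subst (1 ≤_) (∣tabulate∩∣≡∑𝟙 (adj G v) B) (x∈p⇒1≤∣p∣ (∈N∩⁺ G vu u∈B))

  B-side : ∀ u → ∑[ v < m ] 𝟙 (A ! v ∧ E v u) ≤ d * 𝟙 (B ! u)
  B-side u with B ! u
  ... | false = ≤-trans (≤-reflexive (trans (sum-cong-≗ λ v → cong 𝟙 (∧-zeroʳ′ (A ! v) (adj G v u)))
                                            (sum-replicate-zero m)))
                        z≤n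
    where
    ∧-zeroʳ′ : ∀ a b → a ∧ (b ∧ false) ≡ false
    ∧-zeroʳ′ a b = trans (cong (a ∧_) (∧-zeroʳ b)) (∧-zeroʳ a)
  ... | true  = begin
    ∑[ v < m ] 𝟙 (A ! v ∧ (adj G v u ∧ true))
      ≤⟨ ∑-mono-≤ (λ v → ≤-trans (𝟙[a∧b]≤𝟙[b] (A ! v) _)
                                  (≤-reflexive (cong 𝟙 (trans (∧-identityʳ _) (adj-sym G v u))))) ⟩
    ∑[ v < m ] 𝟙 (adj G u v)  ≡⟨ sym (∣tabulate∣≡∑𝟙 (adj G u)) ⟩
    ∣ N G u ∣                 ≤⟨ deg u ⟩
    d                         ≡⟨ sym (*-identityʳ d) ⟩
    d * 1                     ∎

γ≡2 : ∀ (G : Graph) → Fin (n G) → (S : Subset (n G)) →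
      IsTotalDominatingSet G S → ∣ S ∣ ≤ 2 → IsGammaT12 G 2
γ≡2 G v S D ∣S∣≤2 =
  γ-intro {G} S (dominating⇒total12 G D λ v → ≤-trans (∣p∩q∣≤∣q∣ (N G v) S) ∣S∣≤2) ∣S∣≤2
          λ _ → 2≤∣total12∣ G v

-- Complete and complete bipartite graphs

adj-K : ∀ {m} (u v : Fin m) → u ≢ v → adj (K m) u v ≡ true
adj-K {m} u v u≢v = adj-mkGraph⁺ {m} {λ _ _ → true} u≢v refl

γ-K : ∀ m → IsGammaT12 (K (3 + m)) 2
γ-K m = γ≡2 (K (3 + m)) zero (true ∷ true ∷ ⊥) dominating (≤-reflexive (cong (2 +_) (∣⊥∣≡0 (suc m))))
  where
  dominating : IsTotalDominatingSet (K (3 + m)) (true ∷ true ∷ ⊥)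
  dominating zero    = suc zero , adj-K {3 + m} zero (suc zero) (λ ()) , there here
  dominating (suc v) = zero , adj-K (suc v) zero (λ ()) , here

γ-Kbip : ∀ a b → IsGammaT12 (Kbip (suc a) (suc b)) 2
γ-Kbip a b = γ≡2 G zero S dominating (≤-reflexive ∣S∣≡2)
  where
  G = Kbip (suc a) (suc b)
  S : Subset (suc a + suc b)
  S = true ∷ (⊥ ++ (true ∷ ⊥))
  w : Fin (suc a + suc b)
  w = suc a ↑ʳ zero
  ∣S∣≡2 : ∣ S ∣ ≡ 2
  ∣S∣≡2 = cong suc (trans (∣p++q∣≡∣p∣+∣q∣ (⊥ {a}) (true ∷ ⊥ {b}))
                          (cong₂ (λ x y → x + suc y) (∣⊥∣≡0 a) (∣⊥∣≡0 b)))
  w∈S : w ∈ S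
  w∈S = there (∈-++ʳ (⊥ {a}) here)
  a≤w : suc a ≤ toℕ w
  a≤w = ≤-trans (m≤m+n (suc a) 0) (≤-reflexive (sym (toℕ-↑ʳ (suc a) zero)))
  across : ∀ {u v : Fin (suc a + suc b)} → toℕ u < suc a → suc a ≤ toℕ v → adj G u v ≡ true
  across {u} {v} u<a a≤v =
    adj-mkGraph⁺ {r = λ x y → ⌊ toℕ x <? suc a ⌋ ∧ not ⌊ toℕ y <? suc a ⌋}
      (λ u≡v → <-irrefl refl (≤-trans u<a (subst (λ x → suc a ≤ toℕ x) (sym u≡v) a≤v)))
      (cong₂ (λ x y → x ∧ not y) (⌊⌋-true (toℕ u <? suc a) u<a) (⌊⌋-false (toℕ v <? suc a) (≤⇒≯ a≤v)))
  dominating : IsTotalDominatingSet G S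
  dominating v with suc a ≤? toℕ v
  ... | yes a≤v = zero , trans (adj-sym G v zero) (across (s≤s z≤n) a≤v) , here
  ... | no  a≰v = w , across (≰⇒> a≰v) a≤w , w∈S

-- Paths and cycles

cycle-rel : ∀ m → Fin m → Fin m → Bool
cycle-rel m a b = (suc (toℕ a) ≡ᵇ toℕ b) ∨ ((toℕ a ≡ᵇ m ∸ 1) ∧ (toℕ b ≡ᵇ 0))

adj-P⇒adj-C : ∀ {m} {u v : Fin m} → adj (P m) u v ≡ true → adj (C m) u v ≡ true
adj-P⇒adj-C {m} {u} {v} = adj-mkGraph-mono {m} {λ a b → suc (toℕ a) ≡ᵇ toℕ b} {cycle-rel m} {u} {v}
  λ {a} {b} → cong (_∨ ((toℕ a ≡ᵇ m ∸ 1) ∧ (toℕ b ≡ᵇ 0)))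

adj-P-suc : ∀ {m} (u v : Fin m) → adj (P (suc m)) (suc u) (suc v) ≡ adj (P m) u v
adj-P-suc u v = cong (λ b → not b ∧ ((suc (toℕ u) ≡ᵇ toℕ v) ∨ (suc (toℕ v) ≡ᵇ toℕ u)))
                     (trans (isYes≗does (suc u ≟ suc v)) (sym (isYes≗does (u ≟ v))))

CycleSucc : ℕ → ℕ → ℕ → Set
CycleSucc m a b = b ≡ suc a ⊎ (a ≡ m ∸ 1 × b ≡ 0)

cycleSucc : ∀ m a b → ((suc a ≡ᵇ b) ∨ ((a ≡ᵇ m ∸ 1) ∧ (b ≡ᵇ 0))) ≡ true → CycleSucc m a b
cycleSucc m a b e with ∨-true⁻ (suc a ≡ᵇ b) e
... | inj₁ succ = inj₁ (sym (≡ᵇ-true⇒≡ (suc a) b succ))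
... | inj₂ wrap with ∧-true⁻ (a ≡ᵇ m ∸ 1) wrap
...   | last , first = inj₂ (≡ᵇ-true⇒≡ a (m ∸ 1) last , ≡ᵇ-true⇒≡ b 0 first)

adj-C⇒CycleSucc : ∀ {m} {v u : Fin m} → adj (C m) v u ≡ true →
                  CycleSucc m (toℕ v) (toℕ u) ⊎ CycleSucc m (toℕ u) (toℕ v)
adj-C⇒CycleSucc {m} {v} {u} e =
  Sum.map (cycleSucc m _ _) (cycleSucc m _ _) (adj-mkGraph⁻ {m} {cycle-rel m} {v} {u} e)

next prev : ℕ → ℕ → ℕ
next m a = if ⌊ suc a ≟ℕ m ⌋ then 0 else suc a
prev m zero    = m ∸ 1
prev m (suc a) = a

CycleSucc⇒≡next : ∀ {m a b} → b < m → CycleSucc m a b → b ≡ next m a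
CycleSucc⇒≡next {m} {a} b<m (inj₁ refl) rewrite ⌊⌋-false (suc a ≟ℕ m) (<⇒≢ b<m) = refl
CycleSucc⇒≡next {suc m} (s≤s z≤n) (inj₂ (refl , refl)) rewrite ⌊⌋-true (suc m ≟ℕ suc m) refl = refl

CycleSucc⇒≡prev : ∀ {m a b} → CycleSucc m b a → b ≡ prev m a
CycleSucc⇒≡prev (inj₁ refl)          = refl
CycleSucc⇒≡prev (inj₂ (refl , refl)) = refl

degree-C≤2 : ∀ {m} (v : Fin m) → ∣ N (C m) v ∣ ≤ 2
degree-C≤2 {m} v = ∣p∣≤2 (N (C m) v) (next m (toℕ v)) (prev m (toℕ v))
  λ {u} u∈N → Sum.map (CycleSucc⇒≡next (toℕ<n u)) CycleSucc⇒≡prev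
                      (adj-C⇒CycleSucc {m} {v} {u} (∈tabulate⁻ u∈N))

degree-P≤2 : ∀ {m} (v : Fin m) → ∣ N (P m) v ∣ ≤ 2
degree-P≤2 {m} v = ≤-trans (p⊆q⇒∣p∣≤∣q∣ {p = N (P m) v} {N (C m) v} λ {u} u∈N →
                                ∈tabulate⁺ (adj-P⇒adj-C {m} {v} {u} (∈tabulate⁻ u∈N)))
                           (degree-C≤2 v)

dominating-P⇒C : ∀ {m} {S : Subset m} → IsTotalDominatingSet (P m) S → IsTotalDominatingSet (C m) S
dominating-P⇒C {m} D v with D v
... | u , vu , u∈S = u , adj-P⇒adj-C {m} {v} {u} vu , u∈S

evenᵇ : ℕ → Bool
evenᵇ zero    = true
evenᵇ (suc n) = not (evenᵇ n)

evenᵇ[k*2] : ∀ k → evenᵇ (k * 2) ≡ true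
evenᵇ[k*2] zero    = refl
evenᵇ[k*2] (suc k) = cong (not ∘ not) (evenᵇ[k*2] k)

CycleSucc-flips-parity : ∀ k {a b} → CycleSucc (suc k * 2) a b → evenᵇ b ≡ not (evenᵇ a)
CycleSucc-flips-parity k (inj₁ refl)          = refl
CycleSucc-flips-parity k (inj₂ (refl , refl)) = sym (cong (not ∘ not) (evenᵇ[k*2] k))

adj-C-flips-parity : ∀ {k} {v u : Fin (k * 2)} → adj (C (k * 2)) v u ≡ true →
                     evenᵇ (toℕ u) ≡ not (evenᵇ (toℕ v))
adj-C-flips-parity {suc k} {v} {u} e with adj-C⇒CycleSucc {suc k * 2} {v} {u} e
... | inj₁ v→u = CycleSucc-flips-parity k v→u
... | inj₂ u→v = trans (sym (not-involutive _)) (cong not (sym (CycleSucc-flips-parity k u→v)))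

Evens Odds : ∀ m → Subset m
Evens m = tabulate {n = m} (evenᵇ ∘ toℕ)
Odds  m = tabulate {n = m} (not ∘ evenᵇ ∘ toℕ)

∣Evens∣ : ∀ k → ∣ Evens (k * 2) ∣ ≡ k
∣Evens∣ k = trans (∣tabulate∣≡∑𝟙 {k * 2} (evenᵇ ∘ toℕ))
                  (trans (∑𝟙-period-2 k evenᵇ (not-involutive ∘ evenᵇ)) (*-identityʳ k))

∣Odds∣ : ∀ k → ∣ Odds (k * 2) ∣ ≡ k
∣Odds∣ k = trans (∣tabulate∣≡∑𝟙 {k * 2} (not ∘ evenᵇ ∘ toℕ))
                 (trans (∑𝟙-period-2 k (not ∘ evenᵇ) (cong not ∘ not-involutive ∘ evenᵇ))
                        (*-identityʳ k))

cycle-lower-bound : ∀ {m} {S : Subset m} → IsTotalDominatingSet (C m) S → m ≤ 2 * ∣ S ∣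
cycle-lower-bound {m} {S} D =
  subst (_≤ 2 * ∣ S ∣) (∣⊤∣≡n m) (∣A∣≤d*∣B∣ (C m) {⊤} {S} 2 (λ {v} _ → D v) degree-C≤2)

-- C (k * 2) is bipartite, so odd vertices are dominated by even ones and vice versa.
even-cycle-lower-bound : ∀ k {m} {S : Subset m} → k * 2 ≡ m → IsTotalDominatingSet (C m) S →
                         k ≤ 2 * ∣ Evens m ∩ S ∣ × k ≤ 2 * ∣ Odds m ∩ S ∣
even-cycle-lower-bound k {S = S} refl D =
  subst (_≤ 2 * ∣ Evens _ ∩ S ∣) (∣Odds∣ k) (∣A∣≤d*∣B∣ (C (k * 2)) 2 odd⇒even-neighbour degree-C≤2) ,
  subst (_≤ 2 * ∣ Odds _ ∩ S ∣) (∣Evens∣ k) (∣A∣≤d*∣B∣ (C (k * 2)) 2 even⇒odd-neighbour degree-C≤2)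
  where
  odd⇒even-neighbour : ∀ {v} → v ∈ Odds (k * 2) → ∃[ u ] (adj (C (k * 2)) v u ≡ true × u ∈ Evens _ ∩ S)
  odd⇒even-neighbour {v} v∈O with D v
  ... | u , vu , u∈S =
    u , vu , x∈p∩q⁺ (∈tabulate⁺ (trans (adj-C-flips-parity {k} {v} {u} vu) (∈tabulate⁻ v∈O)) , u∈S)
  even⇒odd-neighbour : ∀ {v} → v ∈ Evens (k * 2) → ∃[ u ] (adj (C (k * 2)) v u ≡ true × u ∈ Odds _ ∩ S)
  even⇒odd-neighbour {v} v∈E with D v
  ... | u , vu , u∈S =
    u , vu , x∈p∩q⁺ (∈tabulate⁺ (trans (cong not (adj-C-flips-parity {k} {v} {u} vu))
                                      (trans (not-involutive _) (∈tabulate⁻ v∈E))) , u∈S)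

PathCycleγ : ℕ → ℕ → Set
PathCycleγ n k = IsGammaT12 (P n) k × IsGammaT12 (C n) k

path-cycle-γ : ∀ {m k} (S : Subset m) → IsTotalDominatingSet (P m) S → ∣ S ∣ ≤ k →
               (∀ {S′} → IsTotalDominatingSet (C m) S′ → k ≤ ∣ S′ ∣) → PathCycleγ m k
path-cycle-γ {m} S D ∣S∣≤k lower =
  γ-intro {P m} S (dominating⇒total12-of-degree≤2 (P m) degree-P≤2 D) ∣S∣≤k
          (λ _ → lower ∘ dominating-P⇒C ∘ total12⇒dominating (P m)) ,
  γ-intro {C m} S (dominating⇒total12-of-degree≤2 (C m) degree-C≤2 (dominating-P⇒C D)) ∣S∣≤k
          (λ _ → lower ∘ total12⇒dominating (C m))

0110∷_ : ∀ {m} → Subset m → Subset (4 + m)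
0110∷ S = false ∷ true ∷ true ∷ false ∷ S

dominated-suc : ∀ {m b} {S : Subset m} {v} → ∃[ u ] (adj (P m) v u ≡ true × u ∈ S) →
                ∃[ u ] (adj (P (suc m)) (suc v) u ≡ true × u ∈ b ∷ S)
dominated-suc {v = v} (u , vu , u∈S) = suc u , trans (adj-P-suc v u) vu , there u∈S

0110∷-dominating : ∀ {m} {S : Subset m} → IsTotalDominatingSet (P m) S →
                   IsTotalDominatingSet (P (4 + m)) (0110∷ S)
0110∷-dominating D 0F = 1F , refl , there here
0110∷-dominating D 1F = 2F , refl , there (there here)
0110∷-dominating D 2F = 1F , refl , there here
0110∷-dominating D 3F = 2F , refl , there (there here)
0110∷-dominating D (suc (suc (suc (suc v)))) =
  dominated-suc (dominated-suc (dominated-suc (dominated-suc (D v))))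

0110^_∷_ : ∀ q {m} → Subset m → Subset (q * 4 + m)
0110^ zero  ∷ S = S
0110^ suc q ∷ S = 0110∷ (0110^ q ∷ S)

0110^∷-dominating : ∀ q {m} {S : Subset m} → IsTotalDominatingSet (P m) S →
                    IsTotalDominatingSet (P (q * 4 + m)) (0110^ q ∷ S)
0110^∷-dominating zero    D = D
0110^∷-dominating (suc q) D = 0110∷-dominating (0110^∷-dominating q D)

∣0110^∷∣ : ∀ q {m} (S : Subset m) → ∣ 0110^ q ∷ S ∣ ≡ q * 2 + ∣ S ∣
∣0110^∷∣ zero    S = refl
∣0110^∷∣ (suc q) S = cong (2 +_) (∣0110^∷∣ q S)

⟨011⟩ : Subset 3
⟨011⟩ = false ∷ true ∷ true ∷ []

⟨011⟩-dominating : IsTotalDominatingSet (P 3) ⟨011⟩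
⟨011⟩-dominating 0F = 1F , refl , there here
⟨011⟩-dominating 1F = 2F , refl , there (there here)
⟨011⟩-dominating 2F = 1F , refl , there here

⟨01110⟩ : Subset 5
⟨01110⟩ = false ∷ true ∷ true ∷ true ∷ false ∷ []

⟨01110⟩-dominating : IsTotalDominatingSet (P 5) ⟨01110⟩
⟨01110⟩-dominating 0F = 1F , refl , there here
⟨01110⟩-dominating 1F = 2F , refl , there (there here)
⟨01110⟩-dominating 2F = 1F , refl , there here
⟨01110⟩-dominating 3F = 2F , refl , there (there here)
⟨01110⟩-dominating 4F = 3F , refl , there (there (there here))

⟨11⟩ : Subset 2
⟨11⟩ = true ∷ true ∷ []

⟨11⟩-dominating : IsTotalDominatingSet (P 2) ⟨11⟩
⟨11⟩-dominating 0F = 1F , refl , there here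
⟨11⟩-dominating 1F = 0F , refl , here

path-cycle-γ-4q+3 : ∀ q → PathCycleγ (q * 4 + 3) (q * 2 + 2)
path-cycle-γ-4q+3 q = path-cycle-γ (0110^ q ∷ ⟨011⟩) (0110^∷-dominating q ⟨011⟩-dominating)
  (≤-reflexive (∣0110^∷∣ q ⟨011⟩))
  λ D → 2t≤n+1⇒n≤2s⇒t≤s (≤-reflexive (eq q)) (cycle-lower-bound D)
  where
  eq : ∀ q → 2 * (q * 2 + 2) ≡ q * 4 + 3 + 1
  eq = solve-∀

path-cycle-γ-4q+5 : ∀ q → PathCycleγ (q * 4 + 5) (q * 2 + 3)
path-cycle-γ-4q+5 q = path-cycle-γ (0110^ q ∷ ⟨01110⟩) (0110^∷-dominating q ⟨01110⟩-dominating)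
  (≤-reflexive (∣0110^∷∣ q ⟨01110⟩))
  λ D → 2t≤n+1⇒n≤2s⇒t≤s (≤-reflexive (eq q)) (cycle-lower-bound D)
  where
  eq : ∀ q → 2 * (q * 2 + 3) ≡ q * 4 + 5 + 1
  eq = solve-∀

path-cycle-γ-4q+4 : ∀ q → PathCycleγ (suc q * 4 + 0) (suc q * 2 + 0)
path-cycle-γ-4q+4 q = path-cycle-γ (0110^ suc q ∷ []) (0110^∷-dominating (suc q) λ ())
  (≤-reflexive (∣0110^∷∣ (suc q) []))
  λ D → 2t≤n+1⇒n≤2s⇒t≤s (≤-trans (≤-reflexive (eq q)) (m≤m+n _ 1)) (cycle-lower-bound D)
  where
  eq : ∀ q → 2 * (suc q * 2 + 0) ≡ suc q * 4 + 0
  eq = solve-∀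

path-cycle-γ-4q+6 : ∀ q → PathCycleγ (suc q * 4 + 2) (suc q * 2 + 2)
path-cycle-γ-4q+6 q = path-cycle-γ (0110^ suc q ∷ ⟨11⟩) (0110^∷-dominating (suc q) ⟨11⟩-dominating)
  (≤-reflexive (∣0110^∷∣ (suc q) ⟨11⟩)) lower
  where
  len = suc q * 4 + 2
  k≡ : ∀ q → (q * 2 + 3) * 2 ≡ suc q * 4 + 2
  k≡ = solve-∀
  half-k≡ : ∀ q → 2 * (q + 2) ≡ q * 2 + 3 + 1
  half-k≡ = solve-∀
  sum≡ : ∀ q → (q + 2) + (q + 2) ≡ suc q * 2 + 2
  sum≡ = solve-∀
  lower : ∀ {S} → IsTotalDominatingSet (C len) S → suc q * 2 + 2 ≤ ∣ S ∣
  lower {S} D with even-cycle-lower-bound (q * 2 + 3) (k≡ q) D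
  ... | evens , odds = begin
    suc q * 2 + 2                     ≡⟨ sym (sum≡ q) ⟩
    (q + 2) + (q + 2)                 ≤⟨ +-mono-≤ (half {∣ Evens len ∩ S ∣} evens)
                                                   (half {∣ Odds len ∩ S ∣} odds) ⟩
    ∣ Evens len ∩ S ∣ + ∣ Odds len ∩ S ∣  ≡⟨ sym (∣p∣≡∣f∩p∣+∣¬f∩p∣ (evenᵇ ∘ toℕ) S) ⟩
    ∣ S ∣                             ∎
    where
    open ≤-Reasoning
    half : ∀ {s} → q * 2 + 3 ≤ 2 * s → q + 2 ≤ s
    half = 2t≤n+1⇒n≤2s⇒t≤s (≤-reflexive (half-k≡ q))

-- n ≥ 3 in the four shapes q * 4 + m of the lengths of the sets 0110^ q ∷ base above
data Mod4 : ℕ → Set where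
  4q+3 : ∀ q → Mod4 (q * 4 + 3)
  4q+4 : ∀ q → Mod4 (suc q * 4 + 0)
  4q+5 : ∀ q → Mod4 (q * 4 + 5)
  4q+6 : ∀ q → Mod4 (suc q * 4 + 2)

mod4-suc : ∀ {n} → Mod4 n → Mod4 (4 + n)
mod4-suc (4q+3 q) = 4q+3 (suc q)
mod4-suc (4q+4 q) = 4q+4 (suc q)
mod4-suc (4q+5 q) = 4q+5 (suc q)
mod4-suc (4q+6 q) = 4q+6 (suc q)

mod4 : ∀ m → Mod4 (3 + m)
mod4 0                         = 4q+3 0
mod4 1                         = 4q+4 0
mod4 2                         = 4q+5 0
mod4 3                         = 4q+6 0
mod4 (suc (suc (suc (suc m)))) = mod4-suc (mod4 m)

[q*4+r]%4≡r%4 : ∀ q r → (q * 4 + r) % 4 ≡ r % 4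
[q*4+r]%4≡r%4 q r = trans (cong (_% 4) (+-comm (q * 4) r)) ([m+kn]%n≡m%n r q 4)

[q*4+r]%2≡r%2 : ∀ q r → (q * 4 + r) % 2 ≡ r % 2
[q*4+r]%2≡r%2 q r = trans (cong (_% 2) (reorder q r)) ([m+kn]%n≡m%n r (q * 2) 2)
  where
  reorder : ∀ q r → q * 4 + r ≡ r + q * 2 * 2
  reorder = solve-∀

PathCycleStatement : ℕ → Set
PathCycleStatement n = (n % 2 ≡ 1 → PathCycleγ n ((n + 1) / 2))
                     × (n % 4 ≡ 2 → PathCycleγ n (n / 2 + 1))
                     × (n % 4 ≡ 0 → PathCycleγ n (n / 2))

path-cycle-statement : ∀ n → 3 ≤ n → PathCycleStatement n
path-cycle-statement (suc (suc (suc m))) (s≤s (s≤s (s≤s _))) = by-shape (mod4 m)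
  where
  by-shape : ∀ {n} → Mod4 n → PathCycleStatement n
  by-shape (4q+3 q) =
    (λ _ → subst (PathCycleγ _) (sym (x≡y*d⇒x/d≡y _ 2 (eq q))) (path-cycle-γ-4q+3 q)) ,
    (λ e → contradiction (trans (sym ([q*4+r]%4≡r%4 q 3)) e) λ ()) ,
    (λ e → contradiction (trans (sym ([q*4+r]%4≡r%4 q 3)) e) λ ())
    where
    eq : ∀ q → q * 4 + 3 + 1 ≡ (q * 2 + 2) * 2
    eq = solve-∀
  by-shape (4q+5 q) =
    (λ _ → subst (PathCycleγ _) (sym (x≡y*d⇒x/d≡y _ 2 (eq q))) (path-cycle-γ-4q+5 q)) ,
    (λ e → contradiction (trans (sym ([q*4+r]%4≡r%4 q 5)) e) λ ()) ,
    (λ e → contradiction (trans (sym ([q*4+r]%4≡r%4 q 5)) e) λ ())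
    where
    eq : ∀ q → q * 4 + 5 + 1 ≡ (q * 2 + 3) * 2
    eq = solve-∀
  by-shape (4q+4 q) =
    (λ e → contradiction (trans (sym ([q*4+r]%2≡r%2 (suc q) 0)) e) λ ()) ,
    (λ e → contradiction (trans (sym ([q*4+r]%4≡r%4 (suc q) 0)) e) λ ()) ,
    (λ _ → subst (PathCycleγ _) (sym (x≡y*d⇒x/d≡y _ 2 (eq q))) (path-cycle-γ-4q+4 q))
    where
    eq : ∀ q → suc q * 4 + 0 ≡ (suc q * 2 + 0) * 2
    eq = solve-∀
  by-shape (4q+6 q) =
    (λ e → contradiction (trans (sym ([q*4+r]%2≡r%2 (suc q) 2)) e) λ ()) ,
    (λ _ → subst (PathCycleγ _) (sym (trans (cong (_+ 1) (x≡y*d⇒x/d≡y _ 2 (eq q))) (eq′ q)))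
                 (path-cycle-γ-4q+6 q)) ,
    (λ e → contradiction (trans (sym ([q*4+r]%4≡r%4 (suc q) 2)) e) λ ())
    where
    eq : ∀ q → suc q * 4 + 2 ≡ (suc q * 2 + 1) * 2
    eq = solve-∀
    eq′ : ∀ q → suc q * 2 + 1 + 1 ≡ suc q * 2 + 2
    eq′ = solve-∀

-- Double coronas

module DoubleCorona (H : Graph) where

  private
    k = n H

  D : Graph
  D = doubleCorona H

  u x x′ y y′ : Fin k → Fin (5 * k)
  u  = combine {5} 0F
  x  = combine {5} 1F
  x′ = combine {5} 2F
  y  = combine {5} 3F
  y′ = combine {5} 4F

  -- the relation r of doubleCorona in Defs, read on (block, index) pairs
  R : Fin 5 → Fin k → Fin 5 → Fin k → Bool
  R 0F i 0F j = adj H i j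
  R 0F i 1F j = ⌊ i ≟ j ⌋
  R 1F i 2F j = ⌊ i ≟ j ⌋
  R 0F i 3F j = ⌊ i ≟ j ⌋
  R 3F i 4F j = ⌊ i ≟ j ⌋
  R _  _ _  _ = false

  -- r unfolds remQuot into quotRem, so this is the form that rewrites inside adj D
  quotRem-combine : ∀ (b : Fin 5) (i : Fin k) → quotRem {5} k (combine b i) ≡ (i , b)
  quotRem-combine b i = cong swap (remQuot-combine b i)

  adj-combine : ∀ b c i j → adj D (combine b i) (combine c j) ≡
                            not ⌊ combine {5} b i ≟ combine c j ⌋ ∧ (R b i c j ∨ R c j b i)
  adj-combine b c i j rewrite quotRem-combine b i | quotRem-combine c j with b | c
  ... | 0F | 0F = refl
  ... | 0F | 1F = refl
  ... | 0F | 2F = refl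
  ... | 0F | 3F = refl
  ... | 0F | 4F = refl
  ... | 1F | 0F = refl
  ... | 1F | 1F = refl
  ... | 1F | 2F = refl
  ... | 1F | 3F = refl
  ... | 1F | 4F = refl
  ... | 2F | 0F = refl
  ... | 2F | 1F = refl
  ... | 2F | 2F = refl
  ... | 2F | 3F = refl
  ... | 2F | 4F = refl
  ... | 3F | 0F = refl
  ... | 3F | 1F = refl
  ... | 3F | 2F = refl
  ... | 3F | 3F = refl
  ... | 3F | 4F = refl
  ... | 4F | 0F = refl
  ... | 4F | 1F = refl
  ... | 4F | 2F = refl
  ... | 4F | 3F = refl
  ... | 4F | 4F = refl

  data Edge : Fin 5 → Fin k → Fin 5 → Fin k → Set where
    host : ∀ {i j} → adj H i j ≡ true → Edge 0F i 0F j
    ux   : ∀ {i} → Edge 0F i 1F i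
    xu   : ∀ {i} → Edge 1F i 0F i
    xx′  : ∀ {i} → Edge 1F i 2F i
    x′x  : ∀ {i} → Edge 2F i 1F i
    uy   : ∀ {i} → Edge 0F i 3F i
    yu   : ∀ {i} → Edge 3F i 0F i
    yy′  : ∀ {i} → Edge 3F i 4F i
    y′y  : ∀ {i} → Edge 4F i 3F i

  Edge⇒adj : ∀ {b i c j} → Edge b i c j → adj D (combine b i) (combine c j) ≡ true
  Edge⇒adj {b} {i} {c} {j} e =
    trans (adj-combine b c i j)
          (cong₂ _∧_ (cong not (⌊⌋-false (combine b i ≟ combine c j) (distinct e))) (related e))
    where
    loopless : ∀ {b i} → ¬ Edge b i b i
    loopless (host ii) = adj⇒≢ H ii refl
    distinct : ∀ {b i c j} → Edge b i c j → combine b i ≢ combine c j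
    distinct {b} {i} {c} {j} e eq with combine-injective b i c j eq
    ... | refl , refl = loopless e
    related : ∀ {b i c j} → Edge b i c j → (R b i c j ∨ R c j b i) ≡ true
    related (host {i} {j} ij) = cong (_∨ adj H j i) ij
    related (ux  {i})   = cong (_∨ false) (⌊⌋-true (i ≟ i) refl)
    related (xu  {i})   = ⌊⌋-true (i ≟ i) refl
    related (xx′ {i})   = cong (_∨ false) (⌊⌋-true (i ≟ i) refl)
    related (x′x {i})   = ⌊⌋-true (i ≟ i) refl
    related (uy  {i})   = cong (_∨ false) (⌊⌋-true (i ≟ i) refl)
    related (yu  {i})   = ⌊⌋-true (i ≟ i) refl
    related (yy′ {i})   = cong (_∨ false) (⌊⌋-true (i ≟ i) refl)
    related (y′y {i})   = ⌊⌋-true (i ≟ i) refl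

  R⇒Edge : ∀ b c {i j} → (R b i c j ∨ R c j b i) ≡ true → Edge b i c j
  R⇒Edge 0F 0F {i} {j} e with ∨-true⁻ (adj H i j) e
  ... | inj₁ ij = host ij
  ... | inj₂ ji = host (trans (adj-sym H i j) ji)
  R⇒Edge 0F 1F e rewrite ⌊⌋-true⁻ (∨-false⁻ e) = ux
  R⇒Edge 1F 0F e rewrite ⌊⌋-true⁻ e = xu
  R⇒Edge 1F 2F e rewrite ⌊⌋-true⁻ (∨-false⁻ e) = xx′
  R⇒Edge 2F 1F e rewrite ⌊⌋-true⁻ e = x′x
  R⇒Edge 0F 3F e rewrite ⌊⌋-true⁻ (∨-false⁻ e) = uy
  R⇒Edge 3F 0F e rewrite ⌊⌋-true⁻ e = yu
  R⇒Edge 3F 4F e rewrite ⌊⌋-true⁻ (∨-false⁻ e) = yy′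
  R⇒Edge 4F 3F e rewrite ⌊⌋-true⁻ e = y′y
  R⇒Edge 0F 2F ()
  R⇒Edge 0F 4F ()
  R⇒Edge 1F 1F ()
  R⇒Edge 1F 3F ()
  R⇒Edge 1F 4F ()
  R⇒Edge 2F 0F ()
  R⇒Edge 2F 2F ()
  R⇒Edge 2F 3F ()
  R⇒Edge 2F 4F ()
  R⇒Edge 3F 1F ()
  R⇒Edge 3F 2F ()
  R⇒Edge 3F 3F ()
  R⇒Edge 4F 0F ()
  R⇒Edge 4F 1F ()
  R⇒Edge 4F 2F ()
  R⇒Edge 4F 4F ()

  adj⇒Edge : ∀ {b i c j} → adj D (combine b i) (combine c j) ≡ true → Edge b i c j
  adj⇒Edge {b} {i} {c} {j} e = R⇒Edge b c (proj₂ (∧-true⁻ _ (trans (sym (adj-combine b c i j)) e)))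

  blocks-differ : ∀ b i c j → b ≢ c → combine {5} {k} b i ≢ combine c j
  blocks-differ b i c j b≢c = b≢c ∘ proj₁ ∘ combine-injective b i c j

  combine-view : ∀ w → ∃[ c ] ∃[ j ] (combine {5} {k} c j ≡ w)
  combine-view w = proj₁ (remQuot {5} k w) , proj₂ (remQuot {5} k w) , combine-remQuot {5} k w

  neighbour⇒Edge : ∀ {b i w} → adj D (combine b i) w ≡ true →
                   ∃[ c ] ∃[ j ] (combine c j ≡ w × Edge b i c j)
  neighbour⇒Edge {b} {i} {w} e with combine-view w
  ... | c , j , refl = c , j , refl , adj⇒Edge e

  -- combine 0F i = i ↑ˡ 4 * k: the copy of H occupies the first k positions
  Pendant : Subset (5 * k)
  Pendant = ⊥ {k} ++ ⊤ {4 * k}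

  ∣Pendant∣ : ∣ Pendant ∣ ≡ 4 * k
  ∣Pendant∣ = trans (∣p++q∣≡∣p∣+∣q∣ (⊥ {k}) ⊤) (cong₂ _+_ (∣⊥∣≡0 k) (∣⊤∣≡n (4 * k)))

  u∉Pendant : ∀ i → u i ∉ Pendant
  u∉Pendant i = ∉-++ˡ ⊤ ∉⊥

  ∈Pendant : ∀ b i → combine {5} (suc b) i ∈ Pendant
  ∈Pendant b i = ∈-++ʳ (⊥ {k}) {⊤ {4 * k}} {combine b i} ∈⊤

  module _ (conn : Connected H) (2≤k : 2 ≤ k) {S : Subset (5 * k)} (T : IsTotal12Set D S) where

    private
      dominated-via : ∀ b i → ∃[ c ] ∃[ j ] (Edge b i c j × combine c j ∈ S)
      dominated-via b i = via (total12⇒dominating D T (combine b i))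
        where
        via : ∃[ w ] (adj D (combine b i) w ≡ true × w ∈ S) → ∃[ c ] ∃[ j ] (Edge b i c j × combine c j ∈ S)
        via (w , e , w∈S) with neighbour⇒Edge {b} {i} e
        ... | c , j , refl , edge = c , j , edge , w∈S

      x∈S : ∀ i → x i ∈ S
      x∈S i = from-x′ (dominated-via 2F i)
        where
        from-x′ : ∃[ c ] ∃[ j ] (Edge 2F i c j × combine c j ∈ S) → x i ∈ S
        from-x′ (_ , _ , x′x , x∈S) = x∈S

      y∈S : ∀ i → y i ∈ S
      y∈S i = from-y′ (dominated-via 4F i)
        where
        from-y′ : ∃[ c ] ∃[ j ] (Edge 4F i c j × combine c j ∈ S) → y i ∈ S
        from-y′ (_ , _ , y′y , y∈S) = y∈S

      u∉S : ∀ i → u i ∉ S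
      u∉S i u∈S with connected⇒neighbour H conn 2≤k i
      ... | j , ij = contradiction (≤-trans three-in-N[uj] (proj₂ (T (u j)))) λ { (s≤s (s≤s ())) }
        where
        three-in-N[uj] : 3 ≤ ∣ N D (u j) ∩ S ∣
        three-in-N[uj] = 3≤∣p∣ (∈N∩⁺ D (Edge⇒adj ux) (x∈S j)) (∈N∩⁺ D (Edge⇒adj uy) (y∈S j))
                               (∈N∩⁺ D (Edge⇒adj (host (trans (adj-sym H j i) ij))) u∈S)
                               (blocks-differ 1F j 3F j λ ()) (blocks-differ 1F j 0F i λ ())
                               (blocks-differ 3F j 0F i λ ())

      x′∈S : ∀ i → x′ i ∈ S
      x′∈S i = from-x (dominated-via 1F i)
        where
        from-x : ∃[ c ] ∃[ j ] (Edge 1F i c j × combine c j ∈ S) → x′ i ∈ S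
        from-x (_ , _ , xu  , u∈S)  = contradiction u∈S (u∉S i)
        from-x (_ , _ , xx′ , x′∈S) = x′∈S

      y′∈S : ∀ i → y′ i ∈ S
      y′∈S i = from-y (dominated-via 3F i)
        where
        from-y : ∃[ c ] ∃[ j ] (Edge 3F i c j × combine c j ∈ S) → y′ i ∈ S
        from-y (_ , _ , yu  , u∈S)  = contradiction u∈S (u∉S i)
        from-y (_ , _ , yy′ , y′∈S) = y′∈S

      Pendant⊆S : Pendant ⊆ S
      Pendant⊆S {w} w∈P with combine-view w
      ... | 0F , i , refl = contradiction w∈P (u∉Pendant i)
      ... | 1F , i , refl = x∈S i
      ... | 2F , i , refl = x′∈S i
      ... | 3F , i , refl = y∈S i
      ... | 4F , i , refl = y′∈S i

    4k≤∣total12∣ : 4 * k ≤ ∣ S ∣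
    4k≤∣total12∣ = subst (_≤ ∣ S ∣) ∣Pendant∣ (p⊆q⇒∣p∣≤∣q∣ Pendant⊆S)

  Pendant-dominating : IsTotalDominatingSet D Pendant
  Pendant-dominating w with combine-view w
  ... | 0F , i , refl = x i  , Edge⇒adj ux  , ∈Pendant 0F i
  ... | 1F , i , refl = x′ i , Edge⇒adj xx′ , ∈Pendant 1F i
  ... | 2F , i , refl = x i  , Edge⇒adj x′x , ∈Pendant 0F i
  ... | 3F , i , refl = y′ i , Edge⇒adj yy′ , ∈Pendant 3F i
  ... | 4F , i , refl = y i  , Edge⇒adj y′y , ∈Pendant 2F i

  private
    path-neighbours : Fin 5 → Fin k → Fin (5 * k) × Fin (5 * k)
    path-neighbours 0F i = x i , y i
    path-neighbours 1F i = u i , x′ i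
    path-neighbours 2F i = x i , x i
    path-neighbours 3F i = u i , y′ i
    path-neighbours 4F i = y i , y i

    Edge⇒path-neighbour : ∀ {b i c j} → Edge b i c j → combine c j ∈ Pendant →
      combine c j ≡ proj₁ (path-neighbours b i) ⊎ combine c j ≡ proj₂ (path-neighbours b i)
    Edge⇒path-neighbour (host _) u∈P = contradiction u∈P (u∉Pendant _)
    Edge⇒path-neighbour ux  _ = inj₁ refl
    Edge⇒path-neighbour xu  _ = inj₁ refl
    Edge⇒path-neighbour xx′ _ = inj₂ refl
    Edge⇒path-neighbour x′x _ = inj₁ refl
    Edge⇒path-neighbour uy  _ = inj₂ refl
    Edge⇒path-neighbour yu  _ = inj₁ refl
    Edge⇒path-neighbour yy′ _ = inj₂ refl
    Edge⇒path-neighbour y′y _ = inj₁ refl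

  ∣N∩Pendant∣≤2 : ∀ w → ∣ N D w ∩ Pendant ∣ ≤ 2
  ∣N∩Pendant∣≤2 w with combine-view w
  ... | b , i , refl = ∣p∣≤2 (N D (combine b i) ∩ Pendant)
                             (toℕ (proj₁ (path-neighbours b i))) (toℕ (proj₂ (path-neighbours b i)))
                             (λ v∈ → classify (∈N∩⁻ D v∈))
    where
    classify : ∀ {v} → adj D (combine b i) v ≡ true × v ∈ Pendant →
               toℕ v ≡ toℕ (proj₁ (path-neighbours b i)) ⊎ toℕ v ≡ toℕ (proj₂ (path-neighbours b i))
    classify (e , v∈P) with neighbour⇒Edge {b} {i} e
    ... | c , j , refl , edge = Sum.map (cong toℕ) (cong toℕ) (Edge⇒path-neighbour edge v∈P)

  γ-doubleCorona : Connected H → 2 ≤ k → IsGammaT12 D (4 * k)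
  γ-doubleCorona conn 2≤k = γ-intro {D} Pendant (dominating⇒total12 D Pendant-dominating ∣N∩Pendant∣≤2)
                                    (≤-reflexive ∣Pendant∣) (λ _ → 4k≤∣total12∣ conn 2≤k)

lemma2p1 :
    ((n n₁ n₂ : ℕ) → 3 ≤ n → 1 ≤ n₁ → 1 ≤ n₂ →
      IsGammaT12 (K n) 2 × IsGammaT12 (Kbip n₁ n₂) 2)
    ×
    ((n : ℕ) → 3 ≤ n →
      (n % 2 ≡ 1 → IsGammaT12 (P n) ((n + 1) / 2) × IsGammaT12 (C n) ((n + 1) / 2))
      × (n % 4 ≡ 2 → IsGammaT12 (P n) (n / 2 + 1) × IsGammaT12 (C n) (n / 2 + 1))
      × (n % 4 ≡ 0 → IsGammaT12 (P n) (n / 2) × IsGammaT12 (C n) (n / 2)))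
    ×
    ((H : Graph) → Connected H → 2 ≤ order H →
      IsGammaT12 (doubleCorona H) ((4 * order (doubleCorona H)) / 5))
lemma2p1 = complete-graphs , path-cycle-statement , double-corona
  where
  complete-graphs : ∀ n n₁ n₂ → 3 ≤ n → 1 ≤ n₁ → 1 ≤ n₂ →
                    IsGammaT12 (K n) 2 × IsGammaT12 (Kbip n₁ n₂) 2
  complete-graphs (suc (suc (suc m))) (suc a) (suc b) (s≤s (s≤s (s≤s _))) _ _ = γ-K m , γ-Kbip a b
  double-corona : ∀ H → Connected H → 2 ≤ order H →
                  IsGammaT12 (doubleCorona H) ((4 * order (doubleCorona H)) / 5)
  double-corona H conn 2≤k =
    subst (IsGammaT12 (doubleCorona H)) (sym (x≡y*d⇒x/d≡y _ 5 (reorder (n H))))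
          (DoubleCorona.γ-doubleCorona H conn 2≤k)
    where
    reorder : ∀ k → 4 * (5 * k) ≡ 4 * k * 5
    reorder = solve-∀
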